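{- For every positive integer $n$ and every $k\ge0$, the partial NE-paths of length $n$ having $k$ squares or half-squares are in order-preserving bijection with the $k$-dimensional cubes of the state complex $\mathcal{S}(QR_n)$.
   Context: A partial NE-path is a sequence of links, each a north edge $N$, an east edge $E$, a unit square $\square$, or a partial unit square $\llcorner$, placed consecutively starting at $(0,0)$, where each unit square is attached to the rest of the path by its southwest and northeast corners, and there is at most one partial unit square, which must be the last link, attached by its southwest corner. Its length is $e+2f+g$ ($e$ edges, $f$ squares, $g\in\{0,1\}$ half-squares). Partial NE-paths are ordered by containment (a square contains the NE and EN corners it spans, a final half-square contains a final $N$ or $E$). The robotic arm $QR_n$: $n$ unit links with base at $(0,0)$, each facing N or E; states are the NE lattice paths of length $n$. Moves: corner switch at $i$ (interchange links $i,i+1$ if they are N,E or E,N; involves links $\{i,i+1\}$) and end flip (switch link $n$ between E and N; involves link $\{n\}$). The state complex $\mathcal{S}(QR_n)$ has the states as vertices and, for each state $u$ and each set of $k$ moves applicable at $u$ with pairwise disjoint involved links, a $k$-cube whose $2^k$ vertices are the states obtained by applying subsets of these moves to $u$; cubes are glued along faces and ordered by the face relation. -}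

module Defs where

open import Data.Nat using (ℕ; zero; suc; _+_; _*_; _∸_)
open import Data.Bool using (Bool; true; false)
open import Data.List using (List; []; _∷_; length; foldr)
open import Data.List.Membership.Propositional using (_∈_)
open import Data.List.Relation.Unary.All using (All)
open import Data.List.Relation.Unary.AllPairs using (AllPairs)
open import Data.List.Relation.Binary.Sublist.Propositional using (_⊆_)
open import Data.Vec using (Vec; []; _∷_)
open import Data.Product using (Σ; _×_; _,_; ∃)
open import Data.Empty using (⊥)
open import Data.Unit using (⊤)
open import Relation.Binary.PropositionalEquality using (_≡_; _≢_)
open import Function.Bundles using (_⇔_)

data Link : Set where
  nL eL sq : Link

-- A partial NE-path: a list of full links, possibly followed by one final
-- partial unit square (half-square), recorded by the Boolean 'half'.
record PPath : Set where
  constructor pp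
  field
    links : List Link
    half  : Bool

open PPath public

b2n : Bool → ℕ
b2n true  = 1
b2n false = 0

weight : Link → ℕ
weight nL = 1
weight eL = 1
weight sq = 2

ppLength : PPath → ℕ
ppLength p = foldr (λ l r → weight l + r) 0 (links p) + b2n (half p)

isSq : Link → ℕ
isSq sq = 1
isSq _  = 0

ppSquares : PPath → ℕ
ppSquares p = foldr (λ l r → isSq l + r) 0 (links p) + b2n (half p)

data _≼_ : PPath → PPath → Set where
  nil      : pp [] false ≼ pp [] false
  nil-half : pp [] true  ≼ pp [] true
  half-n   : pp (nL ∷ []) false ≼ pp [] true
  half-e   : pp (eL ∷ []) false ≼ pp [] true
  keep     : ∀ {x xs ys b c} → pp xs b ≼ pp ys c → pp (x ∷ xs) b ≼ pp (x ∷ ys) c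
  sq-ne    : ∀ {xs ys b c} → pp xs b ≼ pp ys c → pp (nL ∷ eL ∷ xs) b ≼ pp (sq ∷ ys) c
  sq-en    : ∀ {xs ys b c} → pp xs b ≼ pp ys c → pp (eL ∷ nL ∷ xs) b ≼ pp (sq ∷ ys) c

PPathOfLength : ℕ → Set
PPathOfLength n = Σ PPath (λ p → ppLength p ≡ n)

-- The robotic arm QR_n  (links indexed 0 .. n-1)

data Dir : Set where
  N E : Dir

toggle : Dir → Dir
toggle N = E
toggle E = N

State : ℕ → Set
State n = Vec Dir n

data Move : Set where
  switch : ℕ → Move   -- corner switch at links i, i+1 (0-indexed)
  flip   : Move

Corner : ∀ {n} → ℕ → State n → Set
Corner zero    (x ∷ y ∷ _) = x ≢ y
Corner (suc i) (_ ∷ xs)    = Corner i xs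
Corner _       _           = ⊥

Applicable : ∀ {n} → State n → Move → Set
Applicable u (switch i) = Corner i u
Applicable u flip       = ⊤  -- always applicable (n ≥ 1 in the theorem)

switchAt : ∀ {n} → ℕ → State n → State n
switchAt zero    (x ∷ y ∷ xs) = y ∷ x ∷ xs
switchAt (suc i) (x ∷ xs)     = x ∷ switchAt i xs
switchAt _       xs           = xs

flipLast : ∀ {n} → State n → State n
flipLast []           = []
flipLast (x ∷ [])     = toggle x ∷ []
flipLast (x ∷ y ∷ xs) = x ∷ flipLast (y ∷ xs)

apply : ∀ {n} → Move → State n → State n
apply (switch i) u = switchAt i u
apply flip       u = flipLast u

applyAll : ∀ {n} → List Move → State n → State n
applyAll ms u = foldr apply u ms

involved : ℕ → Move → List ℕ
involved n (switch i) = i ∷ suc i ∷ []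
involved n flip       = (n ∸ 1) ∷ []

Disjoint : ℕ → Move → Move → Set
Disjoint n m m' = ∀ x → x ∈ involved n m → x ∈ involved n m' → ⊥

record CubeData (n : ℕ) : Set where
  constructor cube
  field
    base       : State n
    moves      : List Move
    applicable : All (Applicable base) moves
    disjoint   : AllPairs (Disjoint n) moves

open CubeData public

dim : ∀ {n} → CubeData n → ℕ
dim c = length (moves c)

IsVertex : ∀ {n} → CubeData n → State n → Set
IsVertex c v = ∃ λ (T : List Move) → T ⊆ moves c × v ≡ applyAll T (base c)

-- cubes are identified (glued) when they have the same vertices
_≈C_ : ∀ {n} → CubeData n → CubeData n → Set
c ≈C d = ∀ v → IsVertex c v ⇔ IsVertex d v

_⊑_ : ∀ {n} → CubeData n → CubeData n → Set
c ⊑ d = ∃ λ (A : List Move) → ∃ λ (B : List Move) → A ⊆ moves d × B ⊆ moves d ×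
          (∀ v → IsVertex c v ⇔
                 (∃ λ (T : List Move) → T ⊆ B × v ≡ applyAll T (applyAll A (base d))))

-- Replacing the two edges
-- of every corner switch by a unit square, and the last edge by a half-square if the end flip is among
-- the moves, turns the cube into a partial NE-path of length n whose squares and half-square are the
-- moves. Its vertex set -- the lattice paths crossing each square as NE or EN and the half-square as
-- N or E -- is exactly the vertex set of the cube, so cubes and partial paths correspond through their
-- vertex sets. Containment of partial paths is inclusion of these vertex sets, and the cube of a
-- contained partial path is a face.

module Submission where

open import Defs
open import Data.Nat using (ℕ; zero; suc; _+_; _∸_; _≤_)
open import Data.Nat.Properties using (≡-irrelevant; +-identityʳ)
open import Data.Bool using (Bool; true; false)
open import Data.List using (List; []; _∷_; map; length; foldr)
open import Data.List.Properties using (length-map)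
open import Data.List.Membership.Propositional using (_∈_)
open import Data.List.Membership.Propositional.Properties using (∈-map⁺; ∈-map⁻)
open import Data.List.Relation.Unary.Any using (here; there)
open import Data.List.Relation.Unary.All as All using (All; []; _∷_)
import Data.List.Relation.Unary.All.Properties as All
open import Data.List.Relation.Unary.AllPairs as AllPairs using (AllPairs; []; _∷_)
import Data.List.Relation.Unary.AllPairs.Properties as AllPairs
open import Data.List.Relation.Binary.Sublist.Propositional using (_⊆_; []; _∷_; _∷ʳ_)
open import Data.List.Relation.Binary.Sublist.Propositional.Properties as Sublist using ()
open import Data.Vec using (Vec; []; _∷_)
open import Data.Product using (Σ; _×_; _,_; ∃; proj₁; map₂)
open import Data.Sum using (_⊎_; inj₁; inj₂; [_,_]′)
import Data.Sum as Sum
open import Data.Sum.Function.Propositional using (_⊎-⇔_)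
open import Data.Empty using (⊥-elim)
open import Data.Unit using (tt)
open import Relation.Nullary using (¬_)
open import Relation.Binary.PropositionalEquality using (_≡_; _≢_; refl; sym; trans; cong; subst; module ≡-Reasoning)
open import Function.Base using (_∘_)
open import Function.Bundles using (_⇔_; mk⇔; Equivalence)
import Function.Properties.Equivalence as ⇔
open Equivalence using (to; from)

-- Fits v xs b: the state v is a vertex of the cube named by the partial path pp xs b.
data Fits : ∀ {k} → Vec Dir k → List Link → Bool → Set where
  done  : Fits [] [] false
  halfN : Fits (N ∷ []) [] true
  halfE : Fits (E ∷ []) [] true
  north : ∀ {k} {v : Vec Dir k} {xs b} → Fits v xs b → Fits (N ∷ v) (nL ∷ xs) b
  east  : ∀ {k} {v : Vec Dir k} {xs b} → Fits v xs b → Fits (E ∷ v) (eL ∷ xs) b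
  sqNE  : ∀ {k} {v : Vec Dir k} {xs b} → Fits v xs b → Fits (N ∷ E ∷ v) (sq ∷ xs) b
  sqEN  : ∀ {k} {v : Vec Dir k} {xs b} → Fits v xs b → Fits (E ∷ N ∷ v) (sq ∷ xs) b

FitsPath : ∀ {k} → Vec Dir k → PPath → Set
FitsPath v p = Fits v (links p) (half p)

fits-length : ∀ {k} {v : Vec Dir k} {xs b} → Fits v xs b → k ≡ ppLength (pp xs b)
fits-length done      = refl
fits-length halfN     = refl
fits-length halfE     = refl
fits-length (north f) = cong suc (fits-length f)
fits-length (east f)  = cong suc (fits-length f)
fits-length (sqNE f)  = cong (λ k → suc (suc k)) (fits-length f)
fits-length (sqEN f)  = cong (λ k → suc (suc k)) (fits-length f)

baseState : ∀ xs b → Vec Dir (ppLength (pp xs b))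
baseState []        false = []
baseState []        true  = N ∷ []
baseState (nL ∷ xs) b     = N ∷ baseState xs b
baseState (eL ∷ xs) b     = E ∷ baseState xs b
baseState (sq ∷ xs) b     = N ∷ E ∷ baseState xs b

data IsBase : ∀ {k} → Vec Dir k → List Link → Bool → Set where
  done  : IsBase [] [] false
  halfN : IsBase (N ∷ []) [] true
  north : ∀ {k} {v : Vec Dir k} {xs b} → IsBase v xs b → IsBase (N ∷ v) (nL ∷ xs) b
  east  : ∀ {k} {v : Vec Dir k} {xs b} → IsBase v xs b → IsBase (E ∷ v) (eL ∷ xs) b
  sqNE  : ∀ {k} {v : Vec Dir k} {xs b} → IsBase v xs b → IsBase (N ∷ E ∷ v) (sq ∷ xs) b

isBase-baseState : ∀ xs b → IsBase (baseState xs b) xs b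
isBase-baseState []        false = done
isBase-baseState []        true  = halfN
isBase-baseState (nL ∷ xs) b     = north (isBase-baseState xs b)
isBase-baseState (eL ∷ xs) b     = east (isBase-baseState xs b)
isBase-baseState (sq ∷ xs) b     = sqNE (isBase-baseState xs b)

isBase⇒fits : ∀ {k} {v : Vec Dir k} {xs b} → IsBase v xs b → Fits v xs b
isBase⇒fits done      = done
isBase⇒fits halfN     = halfN
isBase⇒fits (north c) = north (isBase⇒fits c)
isBase⇒fits (east c)  = east (isBase⇒fits c)
isBase⇒fits (sqNE c)  = sqNE (isBase⇒fits c)

fits-baseState : ∀ xs b → Fits (baseState xs b) xs b
fits-baseState xs b = isBase⇒fits (isBase-baseState xs b)

-- The cube of a partial path

-- the moves of QR_k, relabelled as moves of QR_(1+k) acting on all links but the first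
shift : Move → Move
shift (switch i) = switch (suc i)
shift flip       = flip

cubeMoves : List Link → Bool → List Move
cubeMoves []        false = []
cubeMoves []        true  = flip ∷ []
cubeMoves (nL ∷ xs) b     = map shift (cubeMoves xs b)
cubeMoves (eL ∷ xs) b     = map shift (cubeMoves xs b)
cubeMoves (sq ∷ xs) b     = switch 0 ∷ map shift (map shift (cubeMoves xs b))

length-cubeMoves : ∀ xs b → length (cubeMoves xs b) ≡ ppSquares (pp xs b)
length-cubeMoves []        false = refl
length-cubeMoves []        true  = refl
length-cubeMoves (nL ∷ xs) b     = trans (length-map shift (cubeMoves xs b)) (length-cubeMoves xs b)
length-cubeMoves (eL ∷ xs) b     = trans (length-map shift (cubeMoves xs b)) (length-cubeMoves xs b)
length-cubeMoves (sq ∷ xs) b     = cong suc (begin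
  length (map shift (map shift (cubeMoves xs b))) ≡⟨ length-map shift (map shift (cubeMoves xs b)) ⟩
  length (map shift (cubeMoves xs b))             ≡⟨ length-map shift (cubeMoves xs b) ⟩
  length (cubeMoves xs b)                         ≡⟨ length-cubeMoves xs b ⟩
  ppSquares (pp xs b)                             ∎)
  where open ≡-Reasoning

-- apply (shift m) (x ∷ w) ≡ x ∷ apply m w fails only for the end flip on the empty state w
OnNonemptyArm : ℕ → List Move → Set
OnNonemptyArm k ms = ms ≡ [] ⊎ ∃ λ k′ → k ≡ suc k′

isBase-onNonemptyArm : ∀ {k} {u : Vec Dir k} {xs b} → IsBase u xs b → OnNonemptyArm k (cubeMoves xs b)
isBase-onNonemptyArm done      = inj₁ refl
isBase-onNonemptyArm halfN     = inj₂ (_ , refl)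
isBase-onNonemptyArm (north _) = inj₂ (_ , refl)
isBase-onNonemptyArm (east _)  = inj₂ (_ , refl)
isBase-onNonemptyArm (sqNE _)  = inj₂ (_ , refl)

apply-shift : ∀ {k} m x (w : Vec Dir (suc k)) → apply (shift m) (x ∷ w) ≡ x ∷ apply m w
apply-shift (switch i) x w       = refl
apply-shift flip       x (y ∷ w) = refl

applicable-shift : ∀ {k} {w : Vec Dir k} x {ms} → All (Applicable w) ms → All (Applicable (x ∷ w)) (map shift ms)
applicable-shift x {[]}           []       = []
applicable-shift x {switch i ∷ _} (c ∷ cs) = c ∷ applicable-shift x cs
applicable-shift x {flip ∷ _}     (_ ∷ cs) = tt ∷ applicable-shift x cs

cubeMoves-applicable : ∀ xs b → All (Applicable (baseState xs b)) (cubeMoves xs b)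
cubeMoves-applicable []        false = []
cubeMoves-applicable []        true  = tt ∷ []
cubeMoves-applicable (nL ∷ xs) b     = applicable-shift N (cubeMoves-applicable xs b)
cubeMoves-applicable (eL ∷ xs) b     = applicable-shift E (cubeMoves-applicable xs b)
cubeMoves-applicable (sq ∷ xs) b     = (λ ()) ∷ applicable-shift N (applicable-shift E (cubeMoves-applicable xs b))

involved-shift⁻ : ∀ {L m x} → suc x ∈ involved (suc L) (shift m) → x ∈ involved L m
involved-shift⁻ {m = switch i} (here refl)         = here refl
involved-shift⁻ {m = switch i} (there (here refl)) = there (here refl)
involved-shift⁻ {m = switch i} (there (there ()))
involved-shift⁻ {m = flip}     (here refl)         = here refl
involved-shift⁻ {m = flip}     (there ())

zero∈involved-shift : ∀ {L m} → zero ∈ involved (suc L) (shift m) → m ≡ flip × L ≡ 0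
zero∈involved-shift {m = switch i} (here ())
zero∈involved-shift {m = switch i} (there (here ()))
zero∈involved-shift {m = switch i} (there (there ()))
zero∈involved-shift {m = flip}     (here refl) = refl , refl
zero∈involved-shift {m = flip}     (there ())

disjoint-shift : ∀ {L m m′} → Disjoint L m m′ → Disjoint (suc L) (shift m) (shift m′)
disjoint-shift d zero p q with zero∈involved-shift p | zero∈involved-shift q
... | refl , refl | refl , refl = d 0 (here refl) (here refl)
disjoint-shift d (suc x) p q = d x (involved-shift⁻ p) (involved-shift⁻ q)

allPairs-disjoint-shift : ∀ {L ms} → AllPairs (Disjoint L) ms → AllPairs (Disjoint (suc L)) (map shift ms)
allPairs-disjoint-shift ds = AllPairs.map⁺ (AllPairs.map disjoint-shift ds)

switch0-disjoint-shift² : ∀ {L} ms → OnNonemptyArm L ms →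
                          All (Disjoint (suc (suc L)) (switch 0)) (map shift (map shift ms))
switch0-disjoint-shift² []       _                  = []
switch0-disjoint-shift² (m ∷ ms) (inj₂ (L′ , refl)) = apart m ∷ switch0-disjoint-shift² ms (inj₂ (L′ , refl))
  where
  apart : ∀ m → Disjoint (suc (suc (suc L′))) (switch 0) (shift (shift m))
  apart m .0 (here refl) q with zero∈involved-shift q
  ... | _ , ()
  apart m .1 (there (here refl)) q with zero∈involved-shift (involved-shift⁻ q)
  ... | _ , ()
  apart m x (there (there ())) q

cubeMoves-disjoint : ∀ xs b → AllPairs (Disjoint (ppLength (pp xs b))) (cubeMoves xs b)
cubeMoves-disjoint []        false = []
cubeMoves-disjoint []        true  = [] ∷ []
cubeMoves-disjoint (nL ∷ xs) b     = allPairs-disjoint-shift (cubeMoves-disjoint xs b)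
cubeMoves-disjoint (eL ∷ xs) b     = allPairs-disjoint-shift (cubeMoves-disjoint xs b)
cubeMoves-disjoint (sq ∷ xs) b     =
  switch0-disjoint-shift² _ (isBase-onNonemptyArm (isBase-baseState xs b))
  ∷ allPairs-disjoint-shift (allPairs-disjoint-shift (cubeMoves-disjoint xs b))

toCube : ∀ {n} → PPathOfLength n → CubeData n
toCube (pp xs b , refl) =
  cube (baseState xs b) (cubeMoves xs b) (cubeMoves-applicable xs b) (cubeMoves-disjoint xs b)

-- Vertices of cubes

CubeVertex : ∀ {k} → Vec Dir k → List Move → Vec Dir k → Set
CubeVertex u ms v = ∃ λ (T : List Move) → T ⊆ ms × v ≡ applyAll T u

Spans : ∀ {k} → Vec Dir k → List Move → Vec Dir k → Set
Spans u []       v = v ≡ u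
Spans u (m ∷ ms) v = Spans u ms v ⊎ Spans u ms (apply m v)

switchAt-involutive : ∀ {k} i (v : Vec Dir k) → switchAt i (switchAt i v) ≡ v
switchAt-involutive zero    []          = refl
switchAt-involutive zero    (x ∷ [])    = refl
switchAt-involutive zero    (x ∷ y ∷ v) = refl
switchAt-involutive (suc i) []          = refl
switchAt-involutive (suc i) (x ∷ v)     = cong (x ∷_) (switchAt-involutive i v)

flipLast-involutive : ∀ {k} (v : Vec Dir k) → flipLast (flipLast v) ≡ v
flipLast-involutive []              = refl
flipLast-involutive (N ∷ [])        = refl
flipLast-involutive (E ∷ [])        = refl
flipLast-involutive (x ∷ N ∷ [])    = refl
flipLast-involutive (x ∷ E ∷ [])    = refl
flipLast-involutive (x ∷ y ∷ z ∷ v) = cong (x ∷_) (flipLast-involutive (y ∷ z ∷ v))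

apply-involutive : ∀ {k} m (v : Vec Dir k) → apply m (apply m v) ≡ v
apply-involutive (switch i) v = switchAt-involutive i v
apply-involutive flip       v = flipLast-involutive v

cubeVertex⇔spans : ∀ {k} (u : Vec Dir k) ms v → CubeVertex u ms v ⇔ Spans u ms v
cubeVertex⇔spans u ms v = mk⇔ (⇒ ms) (⇐ ms)
  where
  ⇒ : ∀ ms {v} → CubeVertex u ms v → Spans u ms v
  ⇒ []       (.[] , [] , v≡u) = v≡u
  ⇒ (m ∷ ms) (T , (.m ∷ʳ T⊆ms) , v≡) = inj₁ (⇒ ms (T , T⊆ms , v≡))
  ⇒ (m ∷ ms) (.m ∷ T , (refl ∷ T⊆ms) , v≡) =
    inj₂ (⇒ ms (T , T⊆ms , trans (cong (apply m) v≡) (apply-involutive m (applyAll T u))))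
  ⇐ : ∀ ms {v} → Spans u ms v → CubeVertex u ms v
  ⇐ []       v≡u = [] , [] , v≡u
  ⇐ (m ∷ ms) (inj₁ s) with ⇐ ms s
  ... | T , T⊆ms , v≡ = T , (m ∷ʳ T⊆ms) , v≡
  ⇐ (m ∷ ms) {v} (inj₂ s) with ⇐ ms s
  ... | T , T⊆ms , mv≡ = m ∷ T , (refl ∷ T⊆ms) , trans (sym (apply-involutive m v)) (cong (apply m) mv≡)

spans-shift : ∀ {k} ms x (u : Vec Dir k) a v → OnNonemptyArm k ms →
              Spans (x ∷ u) (map shift ms) (a ∷ v) ⇔ (a ≡ x × Spans u ms v)
spans-shift []       x u a v _ = mk⇔ (λ { refl → refl , refl }) (λ { (refl , refl) → refl })
spans-shift (m ∷ ms) x u a v (inj₂ (k′ , refl)) = mk⇔ ⇒ ⇐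
  where
  shifted = apply-shift m a v
  IH : ∀ w → Spans (x ∷ u) (map shift ms) (a ∷ w) ⇔ (a ≡ x × Spans u ms w)
  IH w = spans-shift ms x u a w (inj₂ (k′ , refl))
  ⇒ : Spans (x ∷ u) (map shift (m ∷ ms)) (a ∷ v) → a ≡ x × Spans u (m ∷ ms) v
  ⇒ (inj₁ s) = map₂ inj₁ (to (IH v) s)
  ⇒ (inj₂ s) = map₂ inj₂ (to (IH (apply m v)) (subst (Spans (x ∷ u) (map shift ms)) shifted s))
  ⇐ : a ≡ x × Spans u (m ∷ ms) v → Spans (x ∷ u) (map shift (m ∷ ms)) (a ∷ v)
  ⇐ (a≡x , inj₁ s) = inj₁ (from (IH v) (a≡x , s))
  ⇐ (a≡x , inj₂ s) = inj₂ (subst (Spans (x ∷ u) (map shift ms)) (sym shifted) (from (IH (apply m v)) (a≡x , s)))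

spans⇔fits : ∀ {k} {u : Vec Dir k} {xs b} → IsBase u xs b → ∀ v → Spans u (cubeMoves xs b) v ⇔ Fits v xs b
spans⇔fits done      []       = mk⇔ (λ { refl → done }) (λ { done → refl })
spans⇔fits halfN     (N ∷ []) = mk⇔ (λ _ → halfN) (λ _ → inj₁ refl)
spans⇔fits halfN     (E ∷ []) = mk⇔ (λ _ → halfE) (λ _ → inj₂ refl)
spans⇔fits {xs = nL ∷ xs} {b} (north {v = u} c) (a ∷ v) = mk⇔ ⇒ ⇐
  where
  S = spans-shift (cubeMoves xs b) N u a v (isBase-onNonemptyArm c)
  ⇒ : Spans (N ∷ u) (map shift (cubeMoves xs b)) (a ∷ v) → Fits (a ∷ v) (nL ∷ xs) b
  ⇒ s with to S s
  ... | refl , s′ = north (to (spans⇔fits c v) s′)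
  ⇐ : Fits (a ∷ v) (nL ∷ xs) b → Spans (N ∷ u) (map shift (cubeMoves xs b)) (a ∷ v)
  ⇐ (north f) = from S (refl , from (spans⇔fits c v) f)
spans⇔fits {xs = eL ∷ xs} {b} (east {v = u} c) (a ∷ v) = mk⇔ ⇒ ⇐
  where
  S = spans-shift (cubeMoves xs b) E u a v (isBase-onNonemptyArm c)
  ⇒ : Spans (E ∷ u) (map shift (cubeMoves xs b)) (a ∷ v) → Fits (a ∷ v) (eL ∷ xs) b
  ⇒ s with to S s
  ... | refl , s′ = east (to (spans⇔fits c v) s′)
  ⇐ : Fits (a ∷ v) (eL ∷ xs) b → Spans (E ∷ u) (map shift (cubeMoves xs b)) (a ∷ v)
  ⇐ (east f) = from S (refl , from (spans⇔fits c v) f)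
spans⇔fits {xs = sq ∷ xs} {b} (sqNE {v = u} c) (a ∷ d ∷ v) = mk⇔ ⇒ ⇐
  where
  ms = cubeMoves xs b
  Square : Dir → Dir → Set
  Square a d = Spans (N ∷ E ∷ u) (map shift (map shift ms)) (a ∷ d ∷ v)
  S₁ : ∀ a d → Square a d ⇔ (a ≡ N × Spans (E ∷ u) (map shift ms) (d ∷ v))
  S₁ a d = spans-shift (map shift ms) N (E ∷ u) a (d ∷ v) (inj₂ (_ , refl))
  S₂ : ∀ d → Spans (E ∷ u) (map shift ms) (d ∷ v) ⇔ (d ≡ E × Spans u ms v)
  S₂ d = spans-shift ms E u d v (isBase-onNonemptyArm c)
  ⇒ : Square a d ⊎ Square d a → Fits (a ∷ d ∷ v) (sq ∷ xs) b
  ⇒ (inj₁ s) with to (S₁ a d) s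
  ... | refl , s′ with to (S₂ d) s′
  ... | refl , s″ = sqNE (to (spans⇔fits c v) s″)
  ⇒ (inj₂ s) with to (S₁ d a) s
  ... | refl , s′ with to (S₂ a) s′
  ... | refl , s″ = sqEN (to (spans⇔fits c v) s″)
  ⇐ : Fits (a ∷ d ∷ v) (sq ∷ xs) b → Square a d ⊎ Square d a
  ⇐ (sqNE f) = inj₁ (from (S₁ N E) (refl , from (S₂ E) (refl , from (spans⇔fits c v) f)))
  ⇐ (sqEN f) = inj₂ (from (S₁ N E) (refl , from (S₂ E) (refl , from (spans⇔fits c v) f)))

isVertex-toCube : ∀ {n} (p : PPathOfLength n) v → IsVertex (toCube p) v ⇔ FitsPath v (proj₁ p)
isVertex-toCube (pp xs b , refl) v = ⇔.trans (cubeVertex⇔spans _ _ v) (spans⇔fits (isBase-baseState xs b) v)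

-- Inserting a move

north-cong : ∀ {k} {v w : Vec Dir k} {xs ys b c x} → Fits v ys c ⇔ (Fits v xs b ⊎ Fits w xs b) →
             Fits (x ∷ v) (nL ∷ ys) c ⇔ (Fits (x ∷ v) (nL ∷ xs) b ⊎ Fits (x ∷ w) (nL ∷ xs) b)
north-cong e = mk⇔ (λ { (north f) → Sum.map north north (to e f) })
                   (λ { (inj₁ (north f)) → north (from e (inj₁ f)) ; (inj₂ (north f)) → north (from e (inj₂ f)) })

east-cong : ∀ {k} {v w : Vec Dir k} {xs ys b c x} → Fits v ys c ⇔ (Fits v xs b ⊎ Fits w xs b) →
            Fits (x ∷ v) (eL ∷ ys) c ⇔ (Fits (x ∷ v) (eL ∷ xs) b ⊎ Fits (x ∷ w) (eL ∷ xs) b)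
east-cong e = mk⇔ (λ { (east f) → Sum.map east east (to e f) })
                  (λ { (inj₁ (east f)) → east (from e (inj₁ f)) ; (inj₂ (east f)) → east (from e (inj₂ f)) })

square-cong : ∀ {k} {v w : Vec Dir k} {xs ys b c x y} → Fits v ys c ⇔ (Fits v xs b ⊎ Fits w xs b) →
              Fits (x ∷ y ∷ v) (sq ∷ ys) c ⇔ (Fits (x ∷ y ∷ v) (sq ∷ xs) b ⊎ Fits (x ∷ y ∷ w) (sq ∷ xs) b)
square-cong e = mk⇔
  (λ { (sqNE f) → Sum.map sqNE sqNE (to e f) ; (sqEN f) → Sum.map sqEN sqEN (to e f) })
  (λ { (inj₁ (sqNE f)) → sqNE (from e (inj₁ f)) ; (inj₁ (sqEN f)) → sqEN (from e (inj₁ f))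
     ; (inj₂ (sqNE f)) → sqNE (from e (inj₂ f)) ; (inj₂ (sqEN f)) → sqEN (from e (inj₂ f)) })

-- the vertices of a cube with one more move are those of the smaller cube and their images under the move
Splits : Move → ∀ {k} → Vec Dir k → List Link → Bool → Set
Splits m v xs b = Fits v xs b ⊎ Fits (apply m v) xs b

data CornerAt : ℕ → List Link → Set where
  cornerNE : ∀ {xs} → CornerAt zero (nL ∷ eL ∷ xs)
  cornerEN : ∀ {xs} → CornerAt zero (eL ∷ nL ∷ xs)
  afterN   : ∀ {i xs} → CornerAt i xs → CornerAt (suc i) (nL ∷ xs)
  afterE   : ∀ {i xs} → CornerAt i xs → CornerAt (suc i) (eL ∷ xs)
  afterSq  : ∀ {i xs} → CornerAt i xs → CornerAt (suc (suc i)) (sq ∷ xs)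

squareAt : ℕ → List Link → List Link
squareAt zero          (nL ∷ eL ∷ xs) = sq ∷ xs
squareAt zero          (eL ∷ nL ∷ xs) = sq ∷ xs
squareAt (suc i)       (nL ∷ xs)      = nL ∷ squareAt i xs
squareAt (suc i)       (eL ∷ xs)      = eL ∷ squareAt i xs
squareAt (suc (suc i)) (sq ∷ xs)      = sq ∷ squareAt i xs
squareAt _             xs             = xs

fits-squareAt : ∀ {i xs} b → CornerAt i xs → ∀ {k} (v : Vec Dir k) →
                Fits v (squareAt i xs) b ⇔ Splits (switch i) v xs b
fits-squareAt b cornerNE []          = mk⇔ (λ ()) (λ { (inj₁ ()) ; (inj₂ ()) })
fits-squareAt b cornerNE (x ∷ [])    = mk⇔ (λ ()) (λ { (inj₁ (north ())) ; (inj₂ (north ())) })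
fits-squareAt b cornerNE (x ∷ y ∷ v) = mk⇔
  (λ { (sqNE f) → inj₁ (north (east f)) ; (sqEN f) → inj₂ (north (east f)) })
  (λ { (inj₁ (north (east f))) → sqNE f ; (inj₂ (north (east f))) → sqEN f })
fits-squareAt b cornerEN []          = mk⇔ (λ ()) (λ { (inj₁ ()) ; (inj₂ ()) })
fits-squareAt b cornerEN (x ∷ [])    = mk⇔ (λ ()) (λ { (inj₁ (east ())) ; (inj₂ (east ())) })
fits-squareAt b cornerEN (x ∷ y ∷ v) = mk⇔
  (λ { (sqEN f) → inj₁ (east (north f)) ; (sqNE f) → inj₂ (east (north f)) })
  (λ { (inj₁ (east (north f))) → sqEN f ; (inj₂ (east (north f))) → sqNE f })
fits-squareAt b (afterN c)  []          = mk⇔ (λ ()) (λ { (inj₁ ()) ; (inj₂ ()) })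
fits-squareAt b (afterN c)  (x ∷ v)     = north-cong (fits-squareAt b c v)
fits-squareAt b (afterE c)  []          = mk⇔ (λ ()) (λ { (inj₁ ()) ; (inj₂ ()) })
fits-squareAt b (afterE c)  (x ∷ v)     = east-cong (fits-squareAt b c v)
fits-squareAt b (afterSq c) []          = mk⇔ (λ ()) (λ { (inj₁ ()) ; (inj₂ ()) })
fits-squareAt b (afterSq c) (x ∷ [])    = mk⇔ (λ ()) (λ { (inj₁ ()) ; (inj₂ ()) })
fits-squareAt b (afterSq c) (x ∷ y ∷ v) = square-cong (fits-squareAt b c v)

data EndsInEdge : List Link → Set where
  lastN : EndsInEdge (nL ∷ [])
  lastE : EndsInEdge (eL ∷ [])
  later : ∀ {x y ys} → EndsInEdge (y ∷ ys) → EndsInEdge (x ∷ y ∷ ys)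

endsInEdge-∷ : ∀ {x ys} → EndsInEdge ys → EndsInEdge (x ∷ ys)
endsInEdge-∷ lastN     = later lastN
endsInEdge-∷ lastE     = later lastE
endsInEdge-∷ (later e) = later (later e)

dropLast : List Link → List Link
dropLast []           = []
dropLast (x ∷ [])     = []
dropLast (x ∷ y ∷ xs) = x ∷ dropLast (y ∷ xs)

single-¬fits : ∀ {a l y ys b} → ¬ Fits (a ∷ []) (l ∷ y ∷ ys) b
single-¬fits (north ())
single-¬fits (east ())

pair-¬fits : ∀ {a c y ys b} → ¬ Fits (a ∷ c ∷ []) (sq ∷ y ∷ ys) b
pair-¬fits (sqNE ())
pair-¬fits (sqEN ())

fits-dropLast : ∀ {xs} → EndsInEdge xs → ∀ {k} (v : Vec Dir k) →
                Fits v (dropLast xs) true ⇔ Splits flip v xs false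
fits-dropLast lastN []          = mk⇔ (λ ()) (λ { (inj₁ ()) ; (inj₂ ()) })
fits-dropLast lastN (N ∷ [])    = mk⇔ (λ { halfN → inj₁ (north done) }) (λ { (inj₁ (north done)) → halfN ; (inj₂ ()) })
fits-dropLast lastN (E ∷ [])    = mk⇔ (λ { halfE → inj₂ (north done) }) (λ { (inj₁ ()) ; (inj₂ (north done)) → halfE })
fits-dropLast lastN (x ∷ y ∷ v) = mk⇔ (λ ()) (λ { (inj₁ (north ())) ; (inj₂ (north ())) })
fits-dropLast lastE []          = mk⇔ (λ ()) (λ { (inj₁ ()) ; (inj₂ ()) })
fits-dropLast lastE (E ∷ [])    = mk⇔ (λ { halfE → inj₁ (east done) }) (λ { (inj₁ (east done)) → halfE ; (inj₂ ()) })
fits-dropLast lastE (N ∷ [])    = mk⇔ (λ { halfN → inj₂ (east done) }) (λ { (inj₁ ()) ; (inj₂ (east done)) → halfN })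
fits-dropLast lastE (x ∷ y ∷ v) = mk⇔ (λ ()) (λ { (inj₁ (east ())) ; (inj₂ (east ())) })
fits-dropLast (later {nL} e) []          = mk⇔ (λ ()) (λ { (inj₁ ()) ; (inj₂ ()) })
fits-dropLast (later {nL} e) (x ∷ [])    = mk⇔ (λ { (north ()) }) [ ⊥-elim ∘ single-¬fits , ⊥-elim ∘ single-¬fits ]′
fits-dropLast (later {nL} e) (x ∷ y ∷ v) = north-cong (fits-dropLast e (y ∷ v))
fits-dropLast (later {eL} e) []          = mk⇔ (λ ()) (λ { (inj₁ ()) ; (inj₂ ()) })
fits-dropLast (later {eL} e) (x ∷ [])    = mk⇔ (λ { (east ()) }) [ ⊥-elim ∘ single-¬fits , ⊥-elim ∘ single-¬fits ]′
fits-dropLast (later {eL} e) (x ∷ y ∷ v) = east-cong (fits-dropLast e (y ∷ v))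
fits-dropLast (later {sq} e) []          = mk⇔ (λ ()) (λ { (inj₁ ()) ; (inj₂ ()) })
fits-dropLast (later {sq} e) (x ∷ [])    = mk⇔ (λ ()) (λ { (inj₁ ()) ; (inj₂ ()) })
fits-dropLast (later {sq} e) (x ∷ y ∷ []) =
  mk⇔ (λ { (sqNE ()) ; (sqEN ()) })
      [ ⊥-elim ∘ pair-¬fits , ⊥-elim ∘ pair-¬fits ]′
fits-dropLast (later {sq} e) (x ∷ y ∷ z ∷ v) = square-cong (fits-dropLast e (z ∷ v))

insertMove : Move → PPath → PPath
insertMove (switch i) (pp xs b) = pp (squareAt i xs) b
insertMove flip       (pp xs b) = pp (dropLast xs) true

Insertable : Move → PPath → Set
Insertable (switch i) p = CornerAt i (links p)
Insertable flip       p = half p ≡ false × EndsInEdge (links p)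

fits-insertMove : ∀ m xs b → Insertable m (pp xs b) → ∀ {k} (v : Vec Dir k) →
                  FitsPath v (insertMove m (pp xs b)) ⇔ Splits m v xs b
fits-insertMove (switch i) xs b     c        v = fits-squareAt b c v
fits-insertMove flip       xs .false (refl , e) v = fits-dropLast e v

ppLength-insertMove : ∀ m p → Insertable m p → ppLength (insertMove m p) ≡ ppLength p
ppLength-insertMove m (pp xs b) ins =
  [ fits-length , fits-length ]′ (to (fits-insertMove m xs b ins _) (fits-baseState _ _))

linksLength : List Link → ℕ
linksLength xs = foldr (λ l r → weight l + r) 0 xs

disjoint-switch-pred : ∀ {L i j} → Disjoint L (switch (suc i)) (switch (suc j)) → Disjoint L (switch i) (switch j)
disjoint-switch-pred d x p q = d (suc x) (∈-map⁺ suc p) (∈-map⁺ suc q)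

cornerAt-squareAt : ∀ {L i j xs} → CornerAt i xs → CornerAt j xs → Disjoint L (switch i) (switch j) →
                    CornerAt i (squareAt j xs)
cornerAt-squareAt cornerNE             cornerNE             d = ⊥-elim (d 0 (here refl) (here refl))
cornerAt-squareAt cornerNE             (afterN cornerEN)    d = ⊥-elim (d 1 (there (here refl)) (here refl))
cornerAt-squareAt cornerNE             (afterN (afterE c))  d = cornerNE
cornerAt-squareAt cornerEN             cornerEN             d = ⊥-elim (d 0 (here refl) (here refl))
cornerAt-squareAt cornerEN             (afterE cornerNE)    d = ⊥-elim (d 1 (there (here refl)) (here refl))
cornerAt-squareAt cornerEN             (afterE (afterN c))  d = cornerEN
cornerAt-squareAt (afterN cornerEN)    cornerNE             d = ⊥-elim (d 1 (here refl) (there (here refl)))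
cornerAt-squareAt (afterN (afterE c))  cornerNE             d = afterSq c
cornerAt-squareAt (afterE cornerNE)    cornerEN             d = ⊥-elim (d 1 (here refl) (there (here refl)))
cornerAt-squareAt (afterE (afterN c))  cornerEN             d = afterSq c
cornerAt-squareAt {L} (afterN ci)  (afterN cj)  d = afterN (cornerAt-squareAt {L} ci cj (disjoint-switch-pred {L} d))
cornerAt-squareAt {L} (afterE ci)  (afterE cj)  d = afterE (cornerAt-squareAt {L} ci cj (disjoint-switch-pred {L} d))
cornerAt-squareAt {L} (afterSq ci) (afterSq cj) d =
  afterSq (cornerAt-squareAt {L} ci cj (disjoint-switch-pred {L} (disjoint-switch-pred {L} d)))

endsInEdge-squareAt : ∀ {j xs} → CornerAt j xs → EndsInEdge xs → linksLength xs ≢ suc (suc j) →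
                      EndsInEdge (squareAt j xs)
endsInEdge-squareAt cornerNE    (later lastE)     ≢ = ⊥-elim (≢ refl)
endsInEdge-squareAt cornerNE    (later (later e)) ≢ = later e
endsInEdge-squareAt cornerEN    (later lastN)     ≢ = ⊥-elim (≢ refl)
endsInEdge-squareAt cornerEN    (later (later e)) ≢ = later e
endsInEdge-squareAt (afterN c)  (later e)         ≢ = endsInEdge-∷ (endsInEdge-squareAt c e (≢ ∘ cong suc))
endsInEdge-squareAt (afterE c)  (later e)         ≢ = endsInEdge-∷ (endsInEdge-squareAt c e (≢ ∘ cong suc))
endsInEdge-squareAt (afterSq c) (later e)         ≢ =
  endsInEdge-∷ (endsInEdge-squareAt c e (≢ ∘ cong (λ k → suc (suc k))))

cornerAt-dropLast : ∀ {j xs} → CornerAt j xs → EndsInEdge xs → linksLength xs ≢ suc (suc j) →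
                    CornerAt j (dropLast xs)
cornerAt-dropLast cornerNE    (later lastE)     ≢ = ⊥-elim (≢ refl)
cornerAt-dropLast cornerNE    (later (later e)) ≢ = cornerNE
cornerAt-dropLast cornerEN    (later lastN)     ≢ = ⊥-elim (≢ refl)
cornerAt-dropLast cornerEN    (later (later e)) ≢ = cornerEN
cornerAt-dropLast (afterN c)  (later e)         ≢ = afterN (cornerAt-dropLast c e (≢ ∘ cong suc))
cornerAt-dropLast (afterE c)  (later e)         ≢ = afterE (cornerAt-dropLast c e (≢ ∘ cong suc))
cornerAt-dropLast (afterSq c) (later e)         ≢ = afterSq (cornerAt-dropLast c e (≢ ∘ cong (λ k → suc (suc k))))

switch-clear-of-end : ∀ {n i} → Disjoint n (switch i) flip → n ≢ suc (suc i)
switch-clear-of-end d refl = d _ (there (here refl)) (here refl)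

linksLength-unhalved : ∀ {xs n} → ppLength (pp xs false) ≡ n → linksLength xs ≡ n
linksLength-unhalved {xs} len = trans (sym (+-identityʳ (linksLength xs))) len

insertable-insertMove : ∀ {n} m m′ p → Insertable m p → Insertable m′ p → Disjoint n m m′ → ppLength p ≡ n →
                        Insertable m (insertMove m′ p)
insertable-insertMove {n} (switch i) (switch j) (pp xs b) ci cj d len = cornerAt-squareAt {n} ci cj d
insertable-insertMove {n} (switch i) flip (pp xs .false) ci (refl , e) d len =
  cornerAt-dropLast ci e (switch-clear-of-end {n} d ∘ trans (sym (linksLength-unhalved {xs} len)))
insertable-insertMove {n} flip (switch j) (pp xs .false) (refl , e) cj d len =
  refl , endsInEdge-squareAt cj e
           (switch-clear-of-end {n} (λ x p q → d x q p) ∘ trans (sym (linksLength-unhalved {xs} len)))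
insertable-insertMove {n} flip flip p _ _ d len = ⊥-elim (d (n ∸ 1) (here refl) (here refl))

edgePath : ∀ {k} → Vec Dir k → List Link
edgePath []      = []
edgePath (N ∷ u) = nL ∷ edgePath u
edgePath (E ∷ u) = eL ∷ edgePath u

fits-edgePath : ∀ {k} (u : Vec Dir k) → Fits u (edgePath u) false
fits-edgePath []      = done
fits-edgePath (N ∷ u) = north (fits-edgePath u)
fits-edgePath (E ∷ u) = east (fits-edgePath u)

fits-edgePath⇒≡ : ∀ {k} (u v : Vec Dir k) → Fits v (edgePath u) false → v ≡ u
fits-edgePath⇒≡ []      []      done      = refl
fits-edgePath⇒≡ (N ∷ u) (N ∷ v) (north f) = cong (N ∷_) (fits-edgePath⇒≡ u v f)
fits-edgePath⇒≡ (E ∷ u) (E ∷ v) (east f)  = cong (E ∷_) (fits-edgePath⇒≡ u v f)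

cornerAt-edgePath : ∀ {k} i (u : Vec Dir k) → Corner i u → CornerAt i (edgePath u)
cornerAt-edgePath zero    (N ∷ N ∷ u) N≢N = ⊥-elim (N≢N refl)
cornerAt-edgePath zero    (N ∷ E ∷ u) _   = cornerNE
cornerAt-edgePath zero    (E ∷ N ∷ u) _   = cornerEN
cornerAt-edgePath zero    (E ∷ E ∷ u) E≢E = ⊥-elim (E≢E refl)
cornerAt-edgePath (suc i) (N ∷ u)     c   = afterN (cornerAt-edgePath i u c)
cornerAt-edgePath (suc i) (E ∷ u)     c   = afterE (cornerAt-edgePath i u c)

endsInEdge-edgePath : ∀ {k} (u : Vec Dir (suc k)) → EndsInEdge (edgePath u)
endsInEdge-edgePath (N ∷ [])    = lastN
endsInEdge-edgePath (E ∷ [])    = lastE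
endsInEdge-edgePath (N ∷ y ∷ u) = endsInEdge-∷ (endsInEdge-edgePath (y ∷ u))
endsInEdge-edgePath (E ∷ y ∷ u) = endsInEdge-∷ (endsInEdge-edgePath (y ∷ u))

cube-path : ∀ {n} → 1 ≤ n → (u : State n) (ms : List Move) →
            All (Applicable u) ms → AllPairs (Disjoint n) ms →
            Σ PPath λ p → ppLength p ≡ n × (∀ v → Spans u ms v ⇔ FitsPath v p) ×
                          (∀ m → Applicable u m → All (Disjoint n m) ms → Insertable m p)
cube-path {suc _} _ u [] _ _ =
  pp (edgePath u) false , sym (fits-length (fits-edgePath u)) ,
  (λ v → mk⇔ (λ { refl → fits-edgePath u }) (fits-edgePath⇒≡ u v)) ,
  λ { (switch i) c _ → cornerAt-edgePath i u c ; flip _ _ → refl , endsInEdge-edgePath u }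
cube-path 1≤n u (m ∷ ms) (a ∷ as) (d ∷ ds) with cube-path 1≤n u ms as ds
... | p , len , spans⇔ , insertable =
  insertMove m p ,
  trans (ppLength-insertMove m p m-ins) len ,
  (λ v → ⇔.trans (spans⇔ v ⊎-⇔ spans⇔ (apply m v)) (⇔.sym (fits-insertMove m (links p) (half p) m-ins v))) ,
  λ { m′ a′ (d′ ∷ ds′) → insertable-insertMove m′ m p (insertable m′ a′ ds′) m-ins d′ len }
  where
  m-ins : Insertable m p
  m-ins = insertable m a d

-- Containment and faces

fits-apply-shift : ∀ {k} {w : Vec Dir k} {xs b} m x → Fits w xs b → m ∈ cubeMoves xs b →
                   apply (shift m) (x ∷ w) ≡ x ∷ apply m w
fits-apply-shift {w = []}    m x done ()
fits-apply-shift {w = y ∷ w} m x _    _ = apply-shift m x (y ∷ w)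

fits-apply : ∀ {k} {w : Vec Dir k} {xs b} → Fits w xs b → ∀ {m} → m ∈ cubeMoves xs b → Fits (apply m w) xs b
fits-apply halfN (here refl) = halfE
fits-apply halfE (here refl) = halfN
fits-apply (north f) m∈ with ∈-map⁻ shift m∈
... | m , m∈′ , refl rewrite fits-apply-shift m N f m∈′ = north (fits-apply f m∈′)
fits-apply (east f) m∈ with ∈-map⁻ shift m∈
... | m , m∈′ , refl rewrite fits-apply-shift m E f m∈′ = east (fits-apply f m∈′)
fits-apply (sqNE f) (here refl) = sqEN f
fits-apply (sqEN f) (here refl) = sqNE f
fits-apply (sqNE {v = w} f) (there m∈) with ∈-map⁻ shift m∈
... | _ , m∈′ , refl with ∈-map⁻ shift m∈′
... | m , m∈″ , refl rewrite apply-shift (shift m) N (E ∷ w) | fits-apply-shift m E f m∈″ =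
  sqNE (fits-apply f m∈″)
fits-apply (sqEN {v = w} f) (there m∈) with ∈-map⁻ shift m∈
... | _ , m∈′ , refl with ∈-map⁻ shift m∈′
... | m , m∈″ , refl rewrite apply-shift (shift m) E (N ∷ w) | fits-apply-shift m N f m∈″ =
  sqEN (fits-apply f m∈″)

fits-applyAll : ∀ {k} {w : Vec Dir k} {xs b} A → (∀ {m} → m ∈ A → m ∈ cubeMoves xs b) →
                Fits w xs b → Fits (applyAll A w) xs b
fits-applyAll []      _    f = f
fits-applyAll (m ∷ A) A⊆ f = fits-apply (fits-applyAll A (A⊆ ∘ there) f) (A⊆ (here refl))

_⊆ᵛ_ : PPath → PPath → Set
p ⊆ᵛ q = ∀ {k} (v : Vec Dir k) → FitsPath v p → FitsPath v q

⊆ᵛ-tail-N : ∀ {xs b ys c} → pp (nL ∷ xs) b ⊆ᵛ pp (nL ∷ ys) c → pp xs b ⊆ᵛ pp ys c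
⊆ᵛ-tail-N H v f with H (N ∷ v) (north f)
... | north g = g

⊆ᵛ-tail-E : ∀ {xs b ys c} → pp (eL ∷ xs) b ⊆ᵛ pp (eL ∷ ys) c → pp xs b ⊆ᵛ pp ys c
⊆ᵛ-tail-E H v f with H (E ∷ v) (east f)
... | east g = g

⊆ᵛ-tail-sq : ∀ {xs b ys c} → pp (sq ∷ xs) b ⊆ᵛ pp (sq ∷ ys) c → pp xs b ⊆ᵛ pp ys c
⊆ᵛ-tail-sq H v f with H (N ∷ E ∷ v) (sqNE f)
... | sqNE g = g

⊆ᵛ-tail-NE : ∀ {xs b ys c} → pp (nL ∷ eL ∷ xs) b ⊆ᵛ pp (sq ∷ ys) c → pp xs b ⊆ᵛ pp ys c
⊆ᵛ-tail-NE H v f with H (N ∷ E ∷ v) (north (east f))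
... | sqNE g = g

⊆ᵛ-tail-EN : ∀ {xs b ys c} → pp (eL ∷ nL ∷ xs) b ⊆ᵛ pp (sq ∷ ys) c → pp xs b ⊆ᵛ pp ys c
⊆ᵛ-tail-EN H v f with H (E ∷ N ∷ v) (east (north f))
... | sqEN g = g

-- The links of q matching the first link of p are found by fitting the base vertex of p (and, for a
-- square, also its switched copy) into q.
mutual
  ⊆ᵛ⇒≼ : ∀ xs b ys c → pp xs b ⊆ᵛ pp ys c → pp xs b ≼ pp ys c
  ⊆ᵛ⇒≼ []        false ys c H with H [] done
  ... | done = nil
  ⊆ᵛ⇒≼ []        true  ys c H with H (N ∷ []) halfN | H (E ∷ []) halfE
  ... | halfN      | _  = nil-half
  ... | north done | ()
  ⊆ᵛ⇒≼ (nL ∷ xs) b ys c H = ⊆ᵛ⇒≼-north xs b ys c H (fits-baseState xs b) (H _ (north (fits-baseState xs b)))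
  ⊆ᵛ⇒≼ (eL ∷ xs) b ys c H = ⊆ᵛ⇒≼-east xs b ys c H (fits-baseState xs b) (H _ (east (fits-baseState xs b)))
  ⊆ᵛ⇒≼ (sq ∷ xs) b ys c H with H _ (sqNE (fits-baseState xs b)) | H _ (sqEN (fits-baseState xs b))
  ... | sqNE _ | _ = keep (⊆ᵛ⇒≼ xs b _ c (⊆ᵛ-tail-sq H))
  ... | north _ | ()

  ⊆ᵛ⇒≼-north : ∀ xs b ys c → pp (nL ∷ xs) b ⊆ᵛ pp ys c → ∀ {k} {w : Vec Dir k} →
               Fits w xs b → Fits (N ∷ w) ys c → pp (nL ∷ xs) b ≼ pp ys c
  ⊆ᵛ⇒≼-north .[]         .false .[]       .true H done      halfN    = half-n
  ⊆ᵛ⇒≼-north xs          b      (nL ∷ ys) c     H _         (north _) = keep (⊆ᵛ⇒≼ xs b ys c (⊆ᵛ-tail-N H))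
  ⊆ᵛ⇒≼-north (eL ∷ xs)   b      (sq ∷ ys) c     H (east _)  (sqNE _) = sq-ne (⊆ᵛ⇒≼ xs b ys c (⊆ᵛ-tail-NE H))
  ⊆ᵛ⇒≼-north .[]         .true  (sq ∷ ys) c     H halfE     (sqNE _) with H (N ∷ N ∷ []) (north halfN)
  ... | ()
  ⊆ᵛ⇒≼-north (sq ∷ xs)   b      (sq ∷ ys) c     H (sqEN f)  (sqNE _) with H _ (north (sqNE f))
  ... | ()

  ⊆ᵛ⇒≼-east : ∀ xs b ys c → pp (eL ∷ xs) b ⊆ᵛ pp ys c → ∀ {k} {w : Vec Dir k} →
              Fits w xs b → Fits (E ∷ w) ys c → pp (eL ∷ xs) b ≼ pp ys c
  ⊆ᵛ⇒≼-east .[]         .false .[]       .true H done      halfE    = half-e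
  ⊆ᵛ⇒≼-east xs          b      (eL ∷ ys) c     H _         (east _) = keep (⊆ᵛ⇒≼ xs b ys c (⊆ᵛ-tail-E H))
  ⊆ᵛ⇒≼-east (nL ∷ xs)   b      (sq ∷ ys) c     H (north _) (sqEN _) = sq-en (⊆ᵛ⇒≼ xs b ys c (⊆ᵛ-tail-EN H))
  ⊆ᵛ⇒≼-east .[]         .true  (sq ∷ ys) c     H halfN     (sqEN _) with H (E ∷ E ∷ []) (east halfE)
  ... | ()
  ⊆ᵛ⇒≼-east (sq ∷ xs)   b      (sq ∷ ys) c     H (sqNE f)  (sqEN _) with H _ (east (sqEN f))
  ... | ()

≼-antisym : ∀ {p q} → p ≼ q → q ≼ p → p ≡ q
≼-antisym nil      nil      = refl
≼-antisym nil-half nil-half = refl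
≼-antisym (keep {x = x} p≼q) (keep q≼p) = cong (λ { (pp xs b) → pp (x ∷ xs) b }) (≼-antisym p≼q q≼p)

applyAll-shift : ∀ {k} A x (w : Vec Dir (suc k)) → applyAll (map shift A) (x ∷ w) ≡ x ∷ applyAll A w
applyAll-shift []      x w = refl
applyAll-shift (m ∷ A) x w = trans (cong (apply (shift m)) (applyAll-shift A x w)) (apply-shift m x (applyAll A w))

applyAll-shift-cubeMoves : ∀ {k} {w : Vec Dir k} {xs b} A x → IsBase w xs b → A ⊆ cubeMoves xs b →
                           applyAll (map shift A) (x ∷ w) ≡ x ∷ applyAll A w
applyAll-shift-cubeMoves {w = []}    .[] x done [] = refl
applyAll-shift-cubeMoves {w = y ∷ w} A   x _    _  = applyAll-shift A x (y ∷ w)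

applyAll-shift² : ∀ {k} {w : Vec Dir k} {xs b} A → IsBase w xs b → A ⊆ cubeMoves xs b →
                  applyAll (map shift (map shift A)) (N ∷ E ∷ w) ≡ N ∷ E ∷ applyAll A w
applyAll-shift² {w = w} A c A⊆ =
  trans (applyAll-shift (map shift A) N (E ∷ w)) (cong (N ∷_) (applyAll-shift-cubeMoves A E c A⊆))

⊆-map-shift : ∀ {A B : List Move} → A ⊆ B → map shift A ⊆ map shift B
⊆-map-shift = Sublist.map⁺ shift

-- The face of the cube of q corresponding to p ≼ q is based where the moves of the squares that p keeps
-- as EN corners (and of a half-square p keeps as E) have been applied to the base of q.
≼⇒face-base : ∀ {p q} → p ≼ q → ∀ {k} {w : Vec Dir k} → IsBase w (links q) (half q) →
              Σ (List Move) λ A → A ⊆ cubeMoves (links q) (half q) × IsBase (applyAll A w) (links p) (half p)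
≼⇒face-base nil      done  = [] , [] , done
≼⇒face-base nil-half halfN = [] , (flip ∷ʳ []) , halfN
≼⇒face-base half-n   halfN = [] , (flip ∷ʳ []) , north done
≼⇒face-base half-e   halfN = flip ∷ [] , (refl ∷ []) , east done
≼⇒face-base (keep {x = nL} p≼q) (north c) with ≼⇒face-base p≼q c
... | A , A⊆ , base = map shift A , ⊆-map-shift A⊆ ,
      subst (λ z → IsBase z _ _) (sym (applyAll-shift-cubeMoves A N c A⊆)) (north base)
≼⇒face-base (keep {x = eL} p≼q) (east c) with ≼⇒face-base p≼q c
... | A , A⊆ , base = map shift A , ⊆-map-shift A⊆ ,
      subst (λ z → IsBase z _ _) (sym (applyAll-shift-cubeMoves A E c A⊆)) (east base)
≼⇒face-base (keep {x = sq} p≼q) (sqNE c) with ≼⇒face-base p≼q c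
... | A , A⊆ , base = map shift (map shift A) , (switch 0 ∷ʳ ⊆-map-shift (⊆-map-shift A⊆)) ,
      subst (λ z → IsBase z _ _) (sym (applyAll-shift² A c A⊆)) (sqNE base)
≼⇒face-base (sq-ne p≼q) (sqNE c) with ≼⇒face-base p≼q c
... | A , A⊆ , base = map shift (map shift A) , (switch 0 ∷ʳ ⊆-map-shift (⊆-map-shift A⊆)) ,
      subst (λ z → IsBase z _ _) (sym (applyAll-shift² A c A⊆)) (north (east base))
≼⇒face-base (sq-en p≼q) (sqNE c) with ≼⇒face-base p≼q c
... | A , A⊆ , base = switch 0 ∷ map shift (map shift A) , (refl ∷ ⊆-map-shift (⊆-map-shift A⊆)) ,
      subst (λ z → IsBase z _ _) (sym (cong (switchAt 0) (applyAll-shift² A c A⊆))) (east (north base))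

≼⇒cubeMoves-⊆ : ∀ {p q} → p ≼ q → cubeMoves (links p) (half p) ⊆ cubeMoves (links q) (half q)
≼⇒cubeMoves-⊆ nil                 = []
≼⇒cubeMoves-⊆ nil-half            = refl ∷ []
≼⇒cubeMoves-⊆ half-n              = flip ∷ʳ []
≼⇒cubeMoves-⊆ half-e              = flip ∷ʳ []
≼⇒cubeMoves-⊆ (keep {x = nL} p≼q) = ⊆-map-shift (≼⇒cubeMoves-⊆ p≼q)
≼⇒cubeMoves-⊆ (keep {x = eL} p≼q) = ⊆-map-shift (≼⇒cubeMoves-⊆ p≼q)
≼⇒cubeMoves-⊆ (keep {x = sq} p≼q) = refl ∷ ⊆-map-shift (⊆-map-shift (≼⇒cubeMoves-⊆ p≼q))
≼⇒cubeMoves-⊆ (sq-ne p≼q)         = switch 0 ∷ʳ ⊆-map-shift (⊆-map-shift (≼⇒cubeMoves-⊆ p≼q))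
≼⇒cubeMoves-⊆ (sq-en p≼q)         = switch 0 ∷ʳ ⊆-map-shift (⊆-map-shift (≼⇒cubeMoves-⊆ p≼q))

dim-toCube : ∀ {n} (p : PPathOfLength n) → dim (toCube p) ≡ ppSquares (proj₁ p)
dim-toCube (pp xs b , refl) = length-cubeMoves xs b

PPathOfLength-≡ : ∀ {n} {p q : PPathOfLength n} → proj₁ p ≡ proj₁ q → p ≡ q
PPathOfLength-≡ {p = p , e} {.p , e′} refl = cong (p ,_) (≡-irrelevant e e′)

fits⊆⇒≼ : ∀ {n} (p q : PPathOfLength n) → (∀ (v : Vec Dir n) → FitsPath v (proj₁ p) → FitsPath v (proj₁ q)) →
          proj₁ p ≼ proj₁ q
fits⊆⇒≼ (pp xs b , refl) (pp ys c , e) H = ⊆ᵛ⇒≼ xs b ys c H′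
  where
  H′ : pp xs b ⊆ᵛ pp ys c
  H′ v f with fits-length f
  ... | refl = H v f

toCube-surjective : ∀ {n} → 1 ≤ n → (c : CubeData n) → ∃ λ p → toCube p ≈C c
toCube-surjective 1≤n (cube u ms as ds) with cube-path 1≤n u ms as ds
... | p , len , spans⇔ , _ = (p , len) , λ v →
  ⇔.trans (isVertex-toCube (p , len) v) (⇔.sym (⇔.trans (cubeVertex⇔spans u ms v) (spans⇔ v)))

toCube-injective : ∀ {n} (p q : PPathOfLength n) → toCube p ≈C toCube q → p ≡ q
toCube-injective p q H = PPathOfLength-≡ (≼-antisym (fits⊆⇒≼ p q p⊆q) (fits⊆⇒≼ q p q⊆p))
  where
  p⊆q : ∀ v → FitsPath v (proj₁ p) → FitsPath v (proj₁ q)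
  p⊆q v = to (isVertex-toCube q v) ∘ to (H v) ∘ from (isVertex-toCube p v)
  q⊆p : ∀ v → FitsPath v (proj₁ q) → FitsPath v (proj₁ p)
  q⊆p v = to (isVertex-toCube p v) ∘ from (H v) ∘ from (isVertex-toCube q v)

≼⇒⊑ : ∀ {n} (p q : PPathOfLength n) → proj₁ p ≼ proj₁ q → toCube p ⊑ toCube q
≼⇒⊑ (p , e) (pp ys c , refl) p≼q with ≼⇒face-base p≼q (isBase-baseState ys c)
... | A , A⊆ , base = A , cubeMoves (links p) (half p) , A⊆ , ≼⇒cubeMoves-⊆ p≼q , λ v →
  ⇔.trans (isVertex-toCube (p , e) v) (⇔.sym (⇔.trans (cubeVertex⇔spans _ _ v) (spans⇔fits base v)))

⊑⇒≼ : ∀ {n} (p q : PPathOfLength n) → toCube p ⊑ toCube q → proj₁ p ≼ proj₁ q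
⊑⇒≼ p (pp ys c , refl) (A , B , A⊆ , B⊆ , H) = fits⊆⇒≼ p (pp ys c , refl) p⊆q
  where
  p⊆q : ∀ v → FitsPath v (proj₁ p) → Fits v ys c
  p⊆q v f with to (H v) (from (isVertex-toCube p v) f)
  ... | T , T⊆B , refl =
    fits-applyAll T (Sublist.Any-resp-⊆ B⊆ ∘ Sublist.Any-resp-⊆ T⊆B)
      (fits-applyAll A (Sublist.Any-resp-⊆ A⊆) (fits-baseState ys c))

lemma4p8 : (n : ℕ) → 1 ≤ n →
    Σ (PPathOfLength n → CubeData n) λ φ →
      (∀ (c : CubeData n) → ∃ λ (p : PPathOfLength n) → φ p ≈C c)
      × (∀ (p q : PPathOfLength n) → φ p ≈C φ q → p ≡ q)
      × (∀ (p q : PPathOfLength n) → (Σ.proj₁ p ≼ Σ.proj₁ q) ⇔ (φ p ⊑ φ q))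
      × (∀ (p : PPathOfLength n) → dim (φ p) ≡ ppSquares (Σ.proj₁ p))
lemma4p8 n 1≤n =
  toCube , toCube-surjective 1≤n , toCube-injective , (λ p q → mk⇔ (≼⇒⊑ p q) (⊑⇒≼ p q)) , dim-toCube
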